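{- Let $\mu=(\mathrm{Val},(\mathcal P,\mathcal O),\varsigma)$ be a model with $\mathrm{Val}=\{0,0.5,1\}$ for the predicate symbols $\mathrm{input},\mathrm{echo}_1,\mathrm{echo}_2,\mathrm{output}$, whose semitopology is 3-twined, and suppose every axiom of $\mathrm{ThyCA}$ is valid in $\mu$. Let $v\in\{0,0.5,1\}$. Then: (1) if $\models\mathsf{Quorum}\,\mathrm{echo}_1(v)$ then $\models\mathsf T\,\mathsf{Contraquorum}\,\mathrm{echo}_1(v)$; (2) if $\models\mathsf T\,\mathsf{Contraquorum}\,\mathrm{echo}_1(v)$ then $\models\mathsf{Everywhere}\,\mathrm{echo}_1(v)$; (3) if $\models\mathsf{Everywhere}\,\mathrm{echo}_1(v)$ then $\models\mathsf T\,\mathsf{Quorum}\,\mathrm{echo}_1(v)$.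
   Context: Truth values: $\mathbf 3=\{\mathbf f,\mathbf b,\mathbf t\}$ totally ordered by $\mathbf f<\mathbf b<\mathbf t$; $\wedge,\vee$ are min and max, $\bigwedge,\bigvee$ are infimum and supremum. Negation: $\neg\mathbf t=\mathbf f$, $\neg\mathbf b=\mathbf b$, $\neg\mathbf f=\mathbf t$. Modalities: $\mathsf T x=\mathbf t$ if $x=\mathbf t$, else $\mathbf f$; $\mathsf B x=\mathbf t$ if $x=\mathbf b$, else $\mathbf f$; $\mathsf{TF}x=\mathbf t$ if $x\in\{\mathbf t,\mathbf f\}$, else $\mathbf f$. Weak implication $x\to_w y:=\neg x\vee y$; strong implication $x\to_s y:=\neg x\vee\mathsf T y$. Exclusive-or: $x\oplus y=\mathbf b$ if $x=\mathbf b$ or $y=\mathbf b$; otherwise $\mathbf t$ if $x\neq y$ and $\mathbf f$ if $x=y$. A truth value is valid iff it lies in $\{\mathbf t,\mathbf b\}$. A semitopology $(\mathcal P,\mathcal O)$ is a set $\mathcal P$ with a family $\mathcal O$ of subsets containing $\mathcal P$ and closed under arbitrary (including empty) unions; $\mathcal O^{\neq\emptyset}$ is the set of nonempty members. It is 3-twined if any three members of $\mathcal O^{\neq\emptyset}$ have nonempty intersection. For $f:\mathcal P\to\mathbf 3$: $\mathsf{Everywhere} f=\bigwedge_{p}f(p)$, $\mathsf{Somewhere} f=\bigvee_p f(p)$, $\mathsf{Quorum} f=\bigvee_{O\in\mathcal O^{\neq\emptyset}}\bigwedge_{p\in O}f(p)$, $\mathsf{Contraquorum} f=\bigwedge_{O\in\mathcal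 O^{\neq\emptyset}}\bigvee_{p\in O}f(p)$. Logic: a model $\mu=(\mathrm{Val},(\mathcal P,\mathcal O),\varsigma)$ consists of a nonempty set $\mathrm{Val}$, a semitopology, and for each predicate symbol $R$ a function $\varsigma(R):\mathcal P\to\mathrm{Val}\to\mathbf 3$. Formulas are built from atoms $R(t)$, value equalities $v\doteq v'$ (denoting $\mathbf t$ if $v=v'$, else $\mathbf f$), connectives $\neg,\wedge,\vee,\to_w,\to_s,\oplus$, modalities $\mathsf T,\mathsf B,\mathsf{TF}$, operators $\mathsf{Everywhere},\mathsf{Somewhere},\mathsf{Quorum},\mathsf{Contraquorum}$ and quantifiers over $\mathrm{Val}$. Denotation $[\![\phi]\!]:\mathcal P\to\mathbf 3$: $[\![R(v)]\!](p)=\varsigma(R)(p)(v)$; connectives and modalities act pointwise in $p$; $[\![\mathsf{Quorum}\,\phi]\!](p)=\mathsf{Quorum}([\![\phi]\!])$ for all $p$, likewise for the other three operators; $[\![\exists a.\phi]\!](p)=\bigvee_{v}[\![\phi[a:=v]]\!](p)$, $[\![\forall a.\phi]\!](p)=\bigwedge_{v}[\![\phi[a:=v]]\!](p)$; $[\![\exists_{01}a.\phi]\!](p)=\bigwedge_{v,v'}\big(([\![\phi[a:=v]]\!](p)\wedge[\![\phi[a:=v']]\!](p))\to_w (v\doteq v')\big)$. $p\models\phi$ iff $[\![\phi]\!](p)\in\{\mathbf t,\mathbf b\}$; $\models\phi$ iff $p\models\phi$ for all $p$. $\mathrm{correct}(R):=\forall a.\mathsf{TF}R(a)$, $\mathrm{incorrect}(R):=\forall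 a.\mathsf B R(a)$, $\mathrm{correct}(R_1,\dots,R_n):=\bigwedge_i\mathrm{correct}(R_i)$. Axioms with a free variable $a$ are universally quantified over $a$; an axiom is valid in $\mu$ if $\models$ it. $\mathrm{ThyCA}$ (with $\mathrm{Val}=\{0,0.5,1\}$) consists of: CaEcho1?: $\mathrm{echo}_1(a)\to_s\mathsf{Somewhere}\,\mathrm{input}(a)$; CaEcho2?: $\mathrm{echo}_2(a)\to_w\mathsf{Quorum}\,\mathrm{echo}_1(a)$; CaOutput?: $(\mathrm{output}(0)\to_w\mathsf{Quorum}\,\mathrm{echo}_2(0))\wedge(\mathrm{output}(1)\to_w\mathsf{Quorum}\,\mathrm{echo}_2(1))$; CaOutput'?: $\mathrm{output}(0.5)\to_w(\mathsf{Quorum}\,\mathrm{echo}_1(0)\wedge\mathsf{Quorum}\,\mathrm{echo}_1(1))$; CaCorrect: $\mathsf{Quorum}\,\mathrm{correct}(\mathrm{input},\mathrm{echo}_1,\mathrm{echo}_2,\mathrm{output})$; CaCorrect': $\mathrm{correct}(R)\vee\mathrm{incorrect}(R)$ for each $R\in\{\mathrm{input},\mathrm{echo}_1,\mathrm{echo}_2,\mathrm{output}\}$; CaInput: $(\mathrm{input}(0)\oplus\mathrm{input}(1))\wedge\neg\mathrm{input}(0.5)$; CaEcho2$_{01}$: $\exists_{01}a.\mathrm{echo}_2(a)$; CaEcho1!: $(\mathrm{input}(a)\vee\mathsf{Contraquorum}\,\mathrm{echo}_1(a))\to_w\mathrm{echo}_1(a)$; CaEcho2!: $(\exists a.\mathsf{Quorum}\,\mathrm{echo}_1(a))\to_w\exists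 a.\mathrm{echo}_2(a)$; CaOutput!: $\mathsf{Quorum}\,\mathrm{echo}_2(a)\to_w\mathrm{output}(a)$; CaOutput'!: $(\mathsf{Quorum}\,\mathrm{echo}_1(0)\wedge\mathsf{Quorum}\,\mathrm{echo}_1(1))\to_w\mathrm{output}(0.5)$. -}

module Defs where

open import Level using (Level; Lift; lift; lower) renaming (suc to lsuc; zero to lzero)
open import Data.Product using (Σ; ∃; _×_; _,_)
open import Data.Empty using (⊥)
open import Data.Unit using (⊤)
open import Relation.Nullary using (Dec; yes; no)
open import Relation.Binary.PropositionalEquality using (_≡_)
open import Axiom.ExcludedMiddle using (ExcludedMiddle)

-- Three truth values, f < b < t

data 𝟛 : Set where
  𝐟 𝐛 𝐭 : 𝟛

_∧₃_ : 𝟛 → 𝟛 → 𝟛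
𝐟 ∧₃ y = 𝐟
𝐛 ∧₃ 𝐟 = 𝐟
𝐛 ∧₃ y = 𝐛
𝐭 ∧₃ y = y

_∨₃_ : 𝟛 → 𝟛 → 𝟛
𝐟 ∨₃ y = y
𝐛 ∨₃ 𝐭 = 𝐭
𝐛 ∨₃ y = 𝐛
𝐭 ∨₃ y = 𝐭

¬₃ : 𝟛 → 𝟛
¬₃ 𝐭 = 𝐟
¬₃ 𝐛 = 𝐛
¬₃ 𝐟 = 𝐭

T₃ : 𝟛 → 𝟛
T₃ 𝐭 = 𝐭
T₃ _ = 𝐟

B₃ : 𝟛 → 𝟛
B₃ 𝐛 = 𝐭
B₃ _ = 𝐟

TF₃ : 𝟛 → 𝟛
TF₃ 𝐛 = 𝐟
TF₃ _ = 𝐭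

_→w_ : 𝟛 → 𝟛 → 𝟛
x →w y = ¬₃ x ∨₃ y

_→s_ : 𝟛 → 𝟛 → 𝟛
x →s y = ¬₃ x ∨₃ T₃ y

_⊕₃_ : 𝟛 → 𝟛 → 𝟛
𝐛 ⊕₃ y = 𝐛
x ⊕₃ 𝐛 = 𝐛
𝐭 ⊕₃ 𝐭 = 𝐟
𝐟 ⊕₃ 𝐟 = 𝐟
𝐭 ⊕₃ 𝐟 = 𝐭
𝐟 ⊕₃ 𝐭 = 𝐭

Valid : 𝟛 → Set
Valid 𝐟 = ⊥
Valid 𝐛 = ⊤
Valid 𝐭 = ⊤

data Val : Set where
  v0 vh v1 : Val   -- 0, 0.5, 1

_≐_ : Val → Val → 𝟛
v0 ≐ v0 = 𝐭
vh ≐ vh = 𝐭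
v1 ≐ v1 = 𝐭
_ ≐ _ = 𝐟

⋀V : (Val → 𝟛) → 𝟛
⋀V φ = φ v0 ∧₃ (φ vh ∧₃ φ v1)

⋁V : (Val → 𝟛) → 𝟛
⋁V φ = φ v0 ∨₃ (φ vh ∨₃ φ v1)

record Semitopology : Set₁ where
  field
    P      : Set
    Open   : (P → Set) → Set
    full   : Open (λ _ → ⊤)
    unions : (I : Set) (U : I → P → Set) → (∀ i → Open (U i)) →
             Open (λ p → ∃ λ i → U i p)

module _ (S : Semitopology) where
  open Semitopology S

  OpenNE : Set₁
  OpenNE = Σ (P → Set) λ U → Open U × (∃ λ p → U p)

  ThreeTwined : Set₁
  ThreeTwined = (U V W : P → Set) →
    Open U → (∃ λ p → U p) → Open V → (∃ λ p → V p) → Open W → (∃ λ p → W p) →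
    ∃ λ p → U p × V p × W p

record Model : Set₁ where
  field
    sto    : Semitopology
  open Semitopology sto public
  field
    input echo₁ echo₂ output : P → Val → 𝟛

-- Semantics.  Infima / suprema over arbitrary index sets require
-- classical logic; we take excluded middle (at level 1) as a parameter.

Classical : Set₂
Classical = ExcludedMiddle (lsuc lzero)

module Sem (lem : Classical) where

  ⋁ : (I : Set₁) → (I → 𝟛) → 𝟛
  ⋁ I g with lem {∃ λ i → g i ≡ 𝐭}
  ... | yes _ = 𝐭
  ... | no _ with lem {∃ λ i → g i ≡ 𝐛}
  ... | yes _ = 𝐛
  ... | no _ = 𝐟

  ⋀ : (I : Set₁) → (I → 𝟛) → 𝟛
  ⋀ I g with lem {∃ λ i → g i ≡ 𝐟}
  ... | yes _ = 𝐟
  ... | no _ with lem {∃ λ i → g i ≡ 𝐛}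
  ... | yes _ = 𝐛
  ... | no _ = 𝐭

  module _ (S : Semitopology) where
    open Semitopology S

    Everywhere : (P → 𝟛) → 𝟛
    Everywhere g = ⋀ (Lift (lsuc lzero) P) (λ p → g (lower p))

    Somewhere : (P → 𝟛) → 𝟛
    Somewhere g = ⋁ (Lift (lsuc lzero) P) (λ p → g (lower p))

    Quorum : (P → 𝟛) → 𝟛
    Quorum g = ⋁ (OpenNE S) λ { (U , _) →
                 ⋀ (Lift (lsuc lzero) (Σ P U)) (λ { (lift (p , _)) → g p }) }

    Contraquorum : (P → 𝟛) → 𝟛
    Contraquorum g = ⋀ (OpenNE S) λ { (U , _) →
                 ⋁ (Lift (lsuc lzero) (Σ P U)) (λ { (lift (p , _)) → g p }) }

  module _ (M : Model) where
    open Model M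

    -- ⊨ φ  (φ given by its denotation P → 3)
    ⊨_ : (P → 𝟛) → Set
    ⊨ φ = (p : P) → Valid (φ p)

    Q CQ EW SW : (P → 𝟛) → 𝟛
    Q  = Quorum sto
    CQ = Contraquorum sto
    EW = Everywhere sto
    SW = Somewhere sto

    correct : (P → Val → 𝟛) → P → 𝟛
    correct R p = ⋀V (λ a → TF₃ (R p a))

    incorrect : (P → Val → 𝟛) → P → 𝟛
    incorrect R p = ⋀V (λ a → B₃ (R p a))

    correctAll : P → 𝟛
    correctAll p = correct input p ∧₃ (correct echo₁ p ∧₃
                   (correct echo₂ p ∧₃ correct output p))

    record ThyCA : Set where
      field
        caEcho1?   : ∀ a → ⊨ (λ p → echo₁ p a →s SW (λ q → input q a))
        caEcho2?   : ∀ a → ⊨ (λ p → echo₂ p a →w Q (λ q → echo₁ q a))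
        caOutput?  : ⊨ (λ p → (output p v0 →w Q (λ q → echo₂ q v0))
                           ∧₃ (output p v1 →w Q (λ q → echo₂ q v1)))
        caOutput'? : ⊨ (λ p → output p vh →w
                           (Q (λ q → echo₁ q v0) ∧₃ Q (λ q → echo₁ q v1)))
        caCorrect  : ⊨ (λ p → Q correctAll)
        caCorrect'-input  : ⊨ (λ p → correct input p ∨₃ incorrect input p)
        caCorrect'-echo₁  : ⊨ (λ p → correct echo₁ p ∨₃ incorrect echo₁ p)
        caCorrect'-echo₂  : ⊨ (λ p → correct echo₂ p ∨₃ incorrect echo₂ p)
        caCorrect'-output : ⊨ (λ p → correct output p ∨₃ incorrect output p)
        caInput    : ⊨ (λ p → (input p v0 ⊕₃ input p v1) ∧₃ ¬₃ (input p vh))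
        caEcho2₀₁  : ⊨ (λ p → ⋀V λ a → ⋀V λ a' →
                           (echo₂ p a ∧₃ echo₂ p a') →w (a ≐ a'))
        caEcho1!   : ∀ a → ⊨ (λ p → (input p a ∨₃ CQ (λ q → echo₁ q a)) →w echo₁ p a)
        caEcho2!   : ⊨ (λ p → ⋁V (λ a → Q (λ q → echo₁ q a)) →w ⋁V (λ a → echo₂ p a))
        caOutput!  : ∀ a → ⊨ (λ p → Q (λ q → echo₂ q a) →w output p a)
        caOutput'! : ⊨ (λ p → (Q (λ q → echo₁ q v0) ∧₃ Q (λ q → echo₁ q v1))
                           →w output p vh)

-- caCorrect supplies a nonempty open set C on which echo₁ never takes the value b.
-- (1) If echo₁(v) is valid on a nonempty open O, then by 3-twinedness every nonempty
-- open U meets O ∩ C, where echo₁(v) is valid and not b, hence t; so the contraquorum is t.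
-- (2) A true contraquorum makes the premise of CaEcho1! true, so echo₁(v) holds everywhere.
-- (3) If echo₁(v) is valid everywhere it is t on C, so the quorum is t.
module Submission where

open import Defs
open import Level using (lift; lower)
open import Data.Product using (Σ; ∃; _×_; _,_; proj₁)
open import Data.Empty using (⊥-elim)
open import Data.Unit using (tt)
open import Relation.Nullary using (yes; no)
open import Relation.Binary.PropositionalEquality using (_≡_; _≢_; refl; subst)

valid∧≢𝐛⇒≡𝐭 : ∀ {x} → Valid x → x ≢ 𝐛 → x ≡ 𝐭
valid∧≢𝐛⇒≡𝐭 {𝐛} _ x≢𝐛 = ⊥-elim (x≢𝐛 refl)
valid∧≢𝐛⇒≡𝐭 {𝐭} _ _   = refl

≡𝐭⇒valid : ∀ {x} → x ≡ 𝐭 → Valid x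
≡𝐭⇒valid refl = tt

≡𝐛⇒valid : ∀ {x} → x ≡ 𝐛 → Valid x
≡𝐛⇒valid refl = tt

valid-∧ˡ : ∀ x {y} → Valid (x ∧₃ y) → Valid x
valid-∧ˡ 𝐛 {𝐛} _ = tt
valid-∧ˡ 𝐛 {𝐭} _ = tt
valid-∧ˡ 𝐭     _ = tt

valid-∧ʳ : ∀ x {y} → Valid (x ∧₃ y) → Valid y
valid-∧ʳ 𝐛 {𝐛} _ = tt
valid-∧ʳ 𝐛 {𝐭} _ = tt
valid-∧ʳ 𝐭     v = v

valid-TF₃⇒≢𝐛 : ∀ {x} → Valid (TF₃ x) → x ≢ 𝐛
valid-TF₃⇒≢𝐛 () refl

valid-T₃⇒≡𝐭 : ∀ {x} → Valid (T₃ x) → x ≡ 𝐭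
valid-T₃⇒≡𝐭 {𝐭} _ = refl

≡𝐭⇒valid-T₃ : ∀ {x} → x ≡ 𝐭 → Valid (T₃ x)
≡𝐭⇒valid-T₃ refl = tt

∨₃-≡𝐭ʳ : ∀ x {y} → y ≡ 𝐭 → x ∨₃ y ≡ 𝐭
∨₃-≡𝐭ʳ 𝐟 refl = refl
∨₃-≡𝐭ʳ 𝐛 refl = refl
∨₃-≡𝐭ʳ 𝐭 refl = refl

valid-→w-mp : ∀ {x y} → x ≡ 𝐭 → Valid (x →w y) → Valid y
valid-→w-mp refl v = v

module Lattice (lem : Classical) where
  open Sem lem

  ⋁-≡𝐭-intro : ∀ I g (i : I) → g i ≡ 𝐭 → ⋁ I g ≡ 𝐭
  ⋁-≡𝐭-intro I g i gi≡𝐭 with lem {∃ λ i → g i ≡ 𝐭}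
  ... | yes _ = refl
  ... | no ∄ = ⊥-elim (∄ (i , gi≡𝐭))

  valid-⋁⁻ : ∀ I g → Valid (⋁ I g) → ∃ λ i → Valid (g i)
  valid-⋁⁻ I g v with lem {∃ λ i → g i ≡ 𝐭}
  ... | yes (i , gi≡𝐭) = i , ≡𝐭⇒valid gi≡𝐭
  ... | no _ with lem {∃ λ i → g i ≡ 𝐛}
  ...   | yes (i , gi≡𝐛) = i , ≡𝐛⇒valid gi≡𝐛
  valid-⋁⁻ I g () | no _ | no _

  valid-⋀⁻ : ∀ I g → Valid (⋀ I g) → ∀ i → Valid (g i)
  valid-⋀⁻ I g v i with lem {∃ λ i → g i ≡ 𝐟}
  valid-⋀⁻ I g () i | yes _
  ... | no ∄ with g i in gi≡
  ...   | 𝐟 = ⊥-elim (∄ (i , gi≡))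
  ...   | 𝐛 = tt
  ...   | 𝐭 = tt

  valid-⋀-intro : ∀ I g → (∀ i → Valid (g i)) → Valid (⋀ I g)
  valid-⋀-intro I g valid with lem {∃ λ i → g i ≡ 𝐟}
  ... | yes (i , gi≡𝐟) = ⊥-elim (subst Valid gi≡𝐟 (valid i))
  ... | no _ with lem {∃ λ i → g i ≡ 𝐛}
  ...   | yes _ = tt
  ...   | no _ = tt

  ⋀-≡𝐭-intro : ∀ I g → (∀ i → g i ≡ 𝐭) → ⋀ I g ≡ 𝐭
  ⋀-≡𝐭-intro I g true with lem {∃ λ i → g i ≡ 𝐟}
  ... | yes (i , gi≡𝐟) with () ← subst (_≡ 𝐭) gi≡𝐟 (true i)
  ... | no _ with lem {∃ λ i → g i ≡ 𝐛}
  ...   | yes (i , gi≡𝐛) with () ← subst (_≡ 𝐭) gi≡𝐛 (true i)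
  ...   | no _ = refl

module Quorums (lem : Classical) (S : Semitopology) where
  open Sem lem
  open Lattice lem
  open Semitopology S

  ValidOn : (P → 𝟛) → (P → Set) → Set
  ValidOn g U = ∀ p → U p → Valid (g p)

  TwoValuedOn : (P → 𝟛) → (P → Set) → Set
  TwoValuedOn g U = ∀ p → U p → g p ≢ 𝐛

  valid-Quorum⁻ : ∀ g → Valid (Quorum S g) → Σ (OpenNE S) λ O → ValidOn g (proj₁ O)
  valid-Quorum⁻ g v with valid-⋁⁻ _ _ v
  ... | O , validO = O , λ p Op → valid-⋀⁻ _ _ validO (lift (p , Op))

  Quorum-≡𝐭-intro : ∀ g (O : OpenNE S) → (∀ p → proj₁ O p → g p ≡ 𝐭) → Quorum S g ≡ 𝐭
  Quorum-≡𝐭-intro g O true =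
    ⋁-≡𝐭-intro _ _ O (⋀-≡𝐭-intro _ _ λ { (lift (p , Op)) → true p Op })

  Contraquorum-≡𝐭-intro : ∀ g →
    (∀ (U : OpenNE S) → ∃ λ p → proj₁ U p × g p ≡ 𝐭) → Contraquorum S g ≡ 𝐭
  Contraquorum-≡𝐭-intro g meets = ⋀-≡𝐭-intro _ _ λ U →
    let p , Up , gp≡𝐭 = meets U in ⋁-≡𝐭-intro _ _ (lift (p , Up)) gp≡𝐭

  valid-Everywhere⁻ : ∀ g → Valid (Everywhere S g) → ∀ p → Valid (g p)
  valid-Everywhere⁻ g v p = valid-⋀⁻ _ _ v (lift p)

  valid-Everywhere-intro : ∀ g → (∀ p → Valid (g p)) → Valid (Everywhere S g)
  valid-Everywhere-intro g valid = valid-⋀-intro _ _ λ p → valid (lower p)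

  valid-Quorum⇒Contraquorum≡𝐭 : ThreeTwined S → ∀ g (C : OpenNE S) →
    TwoValuedOn g (proj₁ C) → Valid (Quorum S g) → Contraquorum S g ≡ 𝐭
  valid-Quorum⇒Contraquorum≡𝐭 twined g (C , oC , neC) twoValued v
    with (O , oO , neO) , validO ← valid-Quorum⁻ g v =
    Contraquorum-≡𝐭-intro g λ (U , oU , neU) →
      let r , Or , Cr , Ur = twined O C U oO neO oC neC oU neU
      in r , Ur , valid∧≢𝐛⇒≡𝐭 (validO r Or) (twoValued r Cr)

  valid-Everywhere⇒Quorum≡𝐭 : ∀ g (C : OpenNE S) →
    TwoValuedOn g (proj₁ C) → Valid (Everywhere S g) → Quorum S g ≡ 𝐭
  valid-Everywhere⇒Quorum≡𝐭 g C twoValued v = Quorum-≡𝐭-intro g C λ p Cp →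
    valid∧≢𝐛⇒≡𝐭 (valid-Everywhere⁻ g v p) (twoValued p Cp)

module CrusaderAgreement (lem : Classical) (M : Model) (thy : Sem.ThyCA lem M) where
  open Sem lem
  open Model M
  open Quorums lem sto
  open ThyCA thy

  valid-correct⇒≢𝐛 : ∀ R {p} v → Valid (correct M R p) → R p v ≢ 𝐛
  valid-correct⇒≢𝐛 R v0 c = valid-TF₃⇒≢𝐛 (valid-∧ˡ (TF₃ (R _ v0)) c)
  valid-correct⇒≢𝐛 R vh c =
    valid-TF₃⇒≢𝐛 (valid-∧ˡ (TF₃ (R _ vh)) (valid-∧ʳ (TF₃ (R _ v0)) c))
  valid-correct⇒≢𝐛 R v1 c =
    valid-TF₃⇒≢𝐛 (valid-∧ʳ (TF₃ (R _ vh)) (valid-∧ʳ (TF₃ (R _ v0)) c))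

  valid-correctAll⇒valid-correct-echo₁ : ∀ {p} → Valid (correctAll M p) → Valid (correct M echo₁ p)
  valid-correctAll⇒valid-correct-echo₁ {p} c =
    valid-∧ˡ (correct M echo₁ p) (valid-∧ʳ (correct M input p) c)

  echo₁-twoValued-open : P → Σ (OpenNE sto) λ C → ∀ v → TwoValuedOn (λ q → echo₁ q v) (proj₁ C)
  echo₁-twoValued-open p with C , validC ← valid-Quorum⁻ (correctAll M) (caCorrect p) =
    C , λ v q Cq → valid-correct⇒≢𝐛 echo₁ v (valid-correctAll⇒valid-correct-echo₁ (validC q Cq))

  Contraquorum-echo₁≡𝐭⇒valid-echo₁ : ∀ v → CQ M (λ q → echo₁ q v) ≡ 𝐭 → ∀ q → Valid (echo₁ q v)
  Contraquorum-echo₁≡𝐭⇒valid-echo₁ v cq≡𝐭 q =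
    valid-→w-mp (∨₃-≡𝐭ʳ (input q v) cq≡𝐭) (caEcho1! v q)

lemma5p14 : (lem : Classical) (M : Model) →
    ThreeTwined (Model.sto M) → Sem.ThyCA lem M → (v : Val) →
    let open Sem lem in
    let e₁ = λ q → Model.echo₁ M q v in
      ((⊨_ M (λ _ → Q M e₁)) → (⊨_ M (λ _ → T₃ (CQ M e₁))))
    × ((⊨_ M (λ _ → T₃ (CQ M e₁))) → (⊨_ M (λ _ → EW M e₁)))
    × ((⊨_ M (λ _ → EW M e₁)) → (⊨_ M (λ _ → T₃ (Q M e₁))))
lemma5p14 lem M twined thy v =
    (λ quorum p → let C , twoValued = echo₁-twoValued-open p in
      ≡𝐭⇒valid-T₃ (valid-Quorum⇒Contraquorum≡𝐭 twined e₁ C (twoValued v) (quorum p)))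
  , (λ contraquorum p → valid-Everywhere-intro e₁
      (Contraquorum-echo₁≡𝐭⇒valid-echo₁ v (valid-T₃⇒≡𝐭 (contraquorum p))))
  , (λ everywhere p → let C , twoValued = echo₁-twoValued-open p in
      ≡𝐭⇒valid-T₃ (valid-Everywhere⇒Quorum≡𝐭 e₁ C (twoValued v) (everywhere p)))
  where
  open Model M
  open Quorums lem sto
  open CrusaderAgreement lem M thy
  e₁ : P → 𝟛
  e₁ q = echo₁ q v
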